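{- For every graph $G$, $\chi(G)\le Z_+(G)+1$, where $\chi(G)$ is the chromatic number of $G$.
   Context: All graphs are finite, simple and undirected. Positive semidefinite colour change rule: vertices are coloured black or white; let $B$ be the set of black vertices and $W_1,\dots,W_r$ the vertex sets of the components of $G-B$; if $u\in B$ and $w\in W_i$ is the only white neighbour of $u$ in the subgraph induced by $B\cup W_i$, then $w$ is recoloured black. $Z_+(G)$ is the minimum size of a set of initially black vertices (all others white) from which repeated application of this rule colours all vertices black. -}

module Defs where

open import Data.Nat using (ℕ; _≤_)
open import Data.Fin using (Fin)
open import Data.Bool using (Bool; true; false)
open import Data.Fin.Subset using (Subset; _∈_; _∉_; _∪_; ⁅_⁆; ⊤; ∣_∣)
open import Data.Product using (Σ; ∃; ∃-syntax; _×_; _,_)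
open import Relation.Binary.PropositionalEquality using (_≡_; _≢_)
open import Relation.Binary.Construct.Closure.ReflexiveTransitive using (Star)

record Graph : Set where
  field
    n      : ℕ
    adj    : Fin n → Fin n → Bool
    sym    : ∀ u v → adj u v ≡ adj v u
    irrefl : ∀ v → adj v v ≡ false
open Graph public

Adj : (G : Graph) → Fin (n G) → Fin (n G) → Set
Adj G u v = adj G u v ≡ true

WhiteEdge : (G : Graph) → Subset (n G) → Fin (n G) → Fin (n G) → Set
WhiteEdge G B u v = u ∉ B × v ∉ B × Adj G u v

SameComponent : (G : Graph) → Subset (n G) → Fin (n G) → Fin (n G) → Set
SameComponent G B w w' = Star (WhiteEdge G B) w w'

-- One application of the positive semidefinite colour change rule:
-- the black set B becomes B ∪ {w}, where u ∈ B, w ∈ W_i is white, and w is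
-- the only white neighbour of u in the subgraph induced by B ∪ W_i
-- (W_i = the component of G - B containing w).
data PSDForce (G : Graph) : Subset (n G) → Subset (n G) → Set where
  force : ∀ {B} (u w : Fin (n G)) →
          u ∈ B → w ∉ B → Adj G u w →
          (∀ w' → w' ∉ B → SameComponent G B w w' → Adj G u w' → w' ≡ w) →
          PSDForce G B (B ∪ ⁅ w ⁆)

IsPSDForcingSet : (G : Graph) → Subset (n G) → Set
IsPSDForcingSet G S = Star (PSDForce G) S ⊤

IsZplus : Graph → ℕ → Set
IsZplus G k =
  (Σ (Subset (n G)) λ S → IsPSDForcingSet G S × ∣ S ∣ ≡ k) ×
  (∀ S → IsPSDForcingSet G S → k ≤ ∣ S ∣)

ProperColouring : (G : Graph) → (c : ℕ) → (Fin (n G) → Fin c) → Set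
ProperColouring G c f = ∀ u v → Adj G u v → f u ≢ f v

IsChromaticNumber : Graph → ℕ → Set
IsChromaticNumber G c =
  (Σ (Fin (n G) → Fin c) λ f → ProperColouring G c f) ×
  (∀ d (f : Fin (n G) → Fin d) → ProperColouring G d f → c ≤ d)

module Submission where

-- Let S be a minimum PSD forcing set.  We colour the vertices black in the
-- order of a forcing chain from S, keeping a colouring c with |S| + 1 colours
-- that satisfies, for the current black set B, the invariant
--   (proper)    c is proper on the black vertices;
--   (injective) for every white x, the black vertices adjacent to the
--               component of x in G - B (the "boundary" of x) have
--               pairwise distinct colours;
--   (missing)   for every white x, some colour is absent from the boundary of x.
-- Initially S gets |S| distinct colours and the extra colour is missing
-- everywhere.  When u forces w, w receives a colour missing from its
-- boundary.  Components only shrink; for a white x that was in the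
-- component of w, the colour c(u) is now missing from its boundary: u is not
-- adjacent to the new component (w was u's only white neighbour there), any
-- other black vertex of colour c(u) would violate injectivity, and w itself
-- got a colour different from c(u).  Once B is everything, c is a proper
-- colouring, so χ(G) ≤ |S| + 1.
--
-- Deciding whether x lies in the component of w is not available
-- constructively, so the (missing) clause and the construction are stated
-- under double negation; this is harmless because χ ≤ z + 1 is decidable.

open import Defs
open import Data.Nat using (ℕ; suc; _≤_; _+_; _≤?_)
open import Data.Nat.Properties using (+-comm)
open import Data.Fin using (Fin; zero; suc; fromℕ; _≟_)
import Data.Fin.Properties as Fin
open import Data.Fin.Subset using (Subset; _∈_; _∉_; _⊆_; _∪_; ⁅_⁆; ⊤; ∣_∣; inside; outside)
open import Data.Fin.Subset.Properties using (∈⊤; x∈⁅x⁆; x∈⁅y⁆⇒x≡y; p⊆p∪q; q⊆p∪q; x∈p∪q⁻)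
open import Data.Vec.Base using (_∷_; here; there)
open import Data.Product using (Σ; _×_; _,_; proj₁)
open import Data.Sum using (_⊎_; inj₁; inj₂)
open import Data.Empty using (⊥-elim)
open import Relation.Nullary using (¬_; yes; no)
open import Relation.Nullary.Decidable using (decidable-stable; ¬¬-excluded-middle)
open import Relation.Binary.PropositionalEquality using (_≡_; _≢_; refl; trans; cong; subst)
import Relation.Binary.PropositionalEquality as ≡
open import Relation.Binary.Construct.Closure.ReflexiveTransitive using (Star; ε; _◅_; _◅◅_; reverse; return)
import Relation.Binary.Construct.Closure.ReflexiveTransitive as Star

label : ∀ {k} (p : Subset k) → Fin k → Fin (suc ∣ p ∣)
label (inside  ∷ p) zero    = zero
label (outside ∷ p) zero    = fromℕ ∣ p ∣
label (inside  ∷ p) (suc i) = suc (label p i)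
label (outside ∷ p) (suc i) = label p i

label-injective : ∀ {k} (p : Subset k) {i j : Fin k} →
                  i ∈ p → j ∈ p → label p i ≡ label p j → i ≡ j
label-injective (inside ∷ p) here      here      _  = refl
label-injective (inside ∷ p) (there i∈p) (there j∈p) eq =
  cong suc (label-injective p i∈p j∈p (Fin.suc-injective eq))
label-injective (outside ∷ p) (there i∈p) (there j∈p) eq =
  cong suc (label-injective p i∈p j∈p eq)

label-not-extra : ∀ {k} (p : Subset k) {i : Fin k} → i ∈ p → label p i ≢ fromℕ ∣ p ∣
label-not-extra (inside ∷ p)  here      ()
label-not-extra (inside ∷ p)  (there i∈p) eq = label-not-extra p i∈p (Fin.suc-injective eq)
label-not-extra (outside ∷ p) (there i∈p) eq = label-not-extra p i∈p eq

recolour : ∀ {k m} → (Fin k → Fin m) → Fin k → Fin m → Fin k → Fin m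
recolour c w a v with v ≟ w
... | yes _ = a
... | no  _ = c v

recolour-here : ∀ {k m} (c : Fin k → Fin m) (w : Fin k) (a : Fin m) → recolour c w a w ≡ a
recolour-here c w a with w ≟ w
... | yes _  = refl
... | no w≢w = ⊥-elim (w≢w refl)

recolour-elsewhere : ∀ {k m} (c : Fin k → Fin m) {w v : Fin k} (a : Fin m) →
                     v ≢ w → recolour c w a v ≡ c v
recolour-elsewhere c {w} {v} a v≢w with v ≟ w
... | yes v≡w = ⊥-elim (v≢w v≡w)
... | no  _   = refl

∈-∪⁅⁆ : ∀ {k} {B : Subset k} {w b : Fin k} → b ∈ B ∪ ⁅ w ⁆ → b ∈ B ⊎ b ≡ w
∈-∪⁅⁆ {B = B} {w} b∈ with x∈p∪q⁻ B ⁅ w ⁆ b∈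
... | inj₁ b∈B = inj₁ b∈B
... | inj₂ b∈w = inj₂ (x∈⁅y⁆⇒x≡y w b∈w)

module _ (G : Graph) where

  V : Set
  V = Fin (n G)

  adj-sym : ∀ {u v : V} → Adj G u v → Adj G v u
  adj-sym {u} {v} a = trans (Defs.sym G v u) a

  adj-irrefl : ∀ {v : V} → ¬ Adj G v v
  adj-irrefl {v} a with () ← trans (≡.sym a) (irrefl G v)

  sameComponent-sym : ∀ {B} {x y : V} → SameComponent G B x y → SameComponent G B y x
  sameComponent-sym = reverse (λ { (x∉B , y∉B , xy) → y∉B , x∉B , adj-sym xy })

  sameComponent-white : ∀ {B} {x y : V} → x ∉ B → SameComponent G B x y → y ∉ B
  sameComponent-white x∉B ε                     = x∉B
  sameComponent-white _   ((_ , x'∉B , _) ◅ p) = sameComponent-white x'∉B p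

  sameComponent-anti : ∀ {B B'} {x y : V} → B ⊆ B' →
                       SameComponent G B' x y → SameComponent G B x y
  sameComponent-anti {B} {B'} B⊆B' =
    Star.map λ { (x∉B' , y∉B' , xy) → white x∉B' , white y∉B' , xy }
    where
    white : ∀ {v} → v ∉ B' → v ∉ B
    white v∉B' v∈B = v∉B' (B⊆B' v∈B)

  Boundary : Subset (n G) → V → V → Set
  Boundary B x b = b ∈ B × Σ V λ y → SameComponent G B x y × Adj G b y

  boundary-transfer : ∀ {B} {x x' b : V} → SameComponent G B x x' →
                      Boundary B x' b → Boundary B x b
  boundary-transfer x~x' (b∈B , y , x'~y , by) = b∈B , y , x~x' ◅◅ x'~y , by

  module _ {m : ℕ} where

    Misses : Subset (n G) → (V → Fin m) → V → Fin m → Set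
    Misses B c x a = ∀ b → Boundary B x b → c b ≢ a

    record ForcingInvariant (B : Subset (n G)) (c : V → Fin m) : Set where
      field
        proper    : ∀ a b → a ∈ B → b ∈ B → Adj G a b → c a ≢ c b
        injective : ∀ x → x ∉ B → ∀ b b' → Boundary B x b → Boundary B x b' →
                    c b ≡ c b' → b ≡ b'
        missing   : ∀ x → x ∉ B → ¬ ¬ (Σ (Fin m) (Misses B c x))

    module ForceStep {B : Subset (n G)} {c : V → Fin m} (I : ForcingInvariant B c)
                     {u w : V} (u∈B : u ∈ B) (w∉B : w ∉ B) (uw : Adj G u w)
                     (unique : ∀ w' → w' ∉ B → SameComponent G B w w' → Adj G u w' → w' ≡ w)
                     {a : Fin m} (a-missing : Misses B c w a) where
      open ForcingInvariant I

      B' : Subset (n G)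
      B' = B ∪ ⁅ w ⁆

      c' : V → Fin m
      c' = recolour c w a

      c'-old : ∀ {b} → b ∈ B → c' b ≡ c b
      c'-old {b} b∈B = recolour-elsewhere c a λ { refl → w∉B b∈B }

      white-before : ∀ {x} → x ∉ B' → x ∉ B
      white-before x∉B' x∈B = x∉B' (p⊆p∪q ⁅ w ⁆ x∈B)

      not-w : ∀ {x} → x ∉ B' → x ≢ w
      not-w x∉B' refl = x∉B' (q⊆p∪q B ⁅ w ⁆ (x∈⁅x⁆ w))

      shrink : ∀ {x y} → SameComponent G B' x y → SameComponent G B x y
      shrink = sameComponent-anti (p⊆p∪q ⁅ w ⁆)

      boundary-old : ∀ {x b} → b ∈ B → Boundary B' x b → Boundary B x b
      boundary-old b∈B (_ , y , x~y , by) = b∈B , y , shrink x~y , by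

      near-w : ∀ {x} → x ∉ B' → Boundary B' x w → SameComponent G B x w
      near-w x∉B' (_ , y , x~y , wy) =
        shrink x~y ◅◅ return (white-before (sameComponent-white x∉B' x~y) , w∉B , adj-sym wy)

      a-fresh : ∀ {x b} → SameComponent G B x w → Boundary B x b → c b ≢ a
      a-fresh x~w ∂b = a-missing _ (boundary-transfer (sameComponent-sym x~w) ∂b)

      proper' : ∀ b₁ b₂ → b₁ ∈ B' → b₂ ∈ B' → Adj G b₁ b₂ → c' b₁ ≢ c' b₂
      proper' b₁ b₂ b₁∈ b₂∈ b₁b₂ eq with ∈-∪⁅⁆ b₁∈ | ∈-∪⁅⁆ b₂∈
      ... | inj₁ b₁∈B | inj₁ b₂∈B =
        proper b₁ b₂ b₁∈B b₂∈B b₁b₂ (trans (≡.sym (c'-old b₁∈B)) (trans eq (c'-old b₂∈B)))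
      ... | inj₂ refl | inj₁ b₂∈B =
        a-missing b₂ (b₂∈B , w , ε , adj-sym b₁b₂)
          (trans (≡.sym (c'-old b₂∈B)) (trans (≡.sym eq) (recolour-here c w a)))
      ... | inj₁ b₁∈B | inj₂ refl =
        a-missing b₁ (b₁∈B , w , ε , b₁b₂)
          (trans (≡.sym (c'-old b₁∈B)) (trans eq (recolour-here c w a)))
      ... | inj₂ refl | inj₂ refl = adj-irrefl b₁b₂

      injective' : ∀ x → x ∉ B' → ∀ b b' → Boundary B' x b → Boundary B' x b' →
                   c' b ≡ c' b' → b ≡ b'
      injective' x x∉B' b b' ∂b ∂b' eq with ∈-∪⁅⁆ (proj₁ ∂b) | ∈-∪⁅⁆ (proj₁ ∂b')
      ... | inj₁ b∈B | inj₁ b'∈B =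
        injective x (white-before x∉B') b b' (boundary-old b∈B ∂b) (boundary-old b'∈B ∂b')
          (trans (≡.sym (c'-old b∈B)) (trans eq (c'-old b'∈B)))
      ... | inj₂ refl | inj₁ b'∈B =
        ⊥-elim (a-fresh (near-w x∉B' ∂b) (boundary-old b'∈B ∂b')
          (trans (≡.sym (c'-old b'∈B)) (trans (≡.sym eq) (recolour-here c w a))))
      ... | inj₁ b∈B | inj₂ refl =
        ⊥-elim (a-fresh (near-w x∉B' ∂b') (boundary-old b∈B ∂b)
          (trans (≡.sym (c'-old b∈B)) (trans eq (recolour-here c w a))))
      ... | inj₂ refl | inj₂ refl = refl

      -- u does not border the new component of any x from the old component
      -- of w: its only white neighbour there was w, which is now black.
      u-not-boundary : ∀ {x} → x ∉ B' → SameComponent G B x w → ¬ Boundary B' x u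
      u-not-boundary x∉B' x~w (_ , y , x~y , uy) =
        not-w (sameComponent-white x∉B' x~y)
          (unique y (white-before (sameComponent-white x∉B' x~y))
                    (sameComponent-sym x~w ◅◅ shrink x~y) uy)

      misses-u : ∀ {x} → x ∉ B' → SameComponent G B x w → Misses B' c' x (c u)
      misses-u x∉B' x~w b ∂b eq with ∈-∪⁅⁆ (proj₁ ∂b)
      ... | inj₂ refl =
        a-missing u (u∈B , w , ε , uw) (≡.sym (trans (≡.sym (recolour-here c w a)) eq))
      ... | inj₁ b∈B with injective _ (white-before x∉B') b u (boundary-old b∈B ∂b)
                                    (u∈B , w , x~w , uw) (trans (≡.sym (c'-old b∈B)) eq)
      ...   | refl = u-not-boundary x∉B' x~w ∂b

      misses-old : ∀ {x a'} → x ∉ B' → ¬ SameComponent G B x w →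
                   Misses B c x a' → Misses B' c' x a'
      misses-old x∉B' x≁w a'-missing b ∂b eq with ∈-∪⁅⁆ (proj₁ ∂b)
      ... | inj₂ refl = x≁w (near-w x∉B' ∂b)
      ... | inj₁ b∈B  = a'-missing b (boundary-old b∈B ∂b) (trans (≡.sym (c'-old b∈B)) eq)

      missing' : ∀ x → x ∉ B' → ¬ ¬ (Σ (Fin m) (Misses B' c' x))
      missing' x x∉B' k = ¬¬-excluded-middle λ
        { (yes x~w) → k (c u , misses-u x∉B' x~w)
        ; (no x≁w)  → missing x (white-before x∉B') λ
            { (a' , a'-missing) → k (a' , misses-old x∉B' x≁w a'-missing) } }

      invariant' : ForcingInvariant B' c'
      invariant' = record { proper = proper' ; injective = injective' ; missing = missing' }

    colour-along : ∀ {B} {c : V → Fin m} → Star (PSDForce G) B ⊤ → ForcingInvariant B c →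
                   ¬ ¬ (Σ (V → Fin m) (ProperColouring G m))
    colour-along {c = c} ε I k = k (c , λ u v uv → ForcingInvariant.proper I u v ∈⊤ ∈⊤ uv)
    colour-along (force u w u∈B w∉B uw unique ◅ chain) I k =
      ForcingInvariant.missing I w w∉B λ
        { (a , a-missing) → let open ForceStep I u∈B w∉B uw unique a-missing in
                            colour-along chain invariant' k }

  initial-invariant : (S : Subset (n G)) → ForcingInvariant S (label S)
  initial-invariant S = record
    { proper    = λ { a b a∈S b∈S ab eq →
                      adj-irrefl (subst (Adj G a) (≡.sym (label-injective S a∈S b∈S eq)) ab) }
    ; injective = λ { _ _ _ _ (b∈S , _) (b'∈S , _) eq → label-injective S b∈S b'∈S eq }
    ; missing   = λ { _ _ k → k (fromℕ ∣ S ∣ , λ { b (b∈S , _) → label-not-extra S b∈S }) } }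

  forcingSet-colouring : (S : Subset (n G)) → IsPSDForcingSet G S →
                         ¬ ¬ (Σ (V → Fin (suc ∣ S ∣)) (ProperColouring G (suc ∣ S ∣)))
  forcingSet-colouring S forcing = colour-along forcing (initial-invariant S)

corollary6p39 : (G : Graph) (χ z : ℕ) → IsChromaticNumber G χ → IsZplus G z → χ ≤ z + 1
corollary6p39 G χ z (_ , minimal) ((S , forcing , |S|≡z) , _) =
  decidable-stable (χ ≤? z + 1) λ χ≰z+1 →
    forcingSet-colouring G S forcing λ { (f , f-proper) →
      χ≰z+1 (subst (χ ≤_) |S|+1≡z+1 (minimal (suc ∣ S ∣) f f-proper)) }
  where
  |S|+1≡z+1 : suc ∣ S ∣ ≡ z + 1
  |S|+1≡z+1 = trans (cong suc |S|≡z) (+-comm 1 z)
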